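{- Let $G$ be a finite simple connected graph of order $n\ge 5$ and size $m$. If $G$ has a maximum matching $M$ with $|M|=k$, then $\chi'_L(G)\le m-k+1$. This bound is attained by the cycle $C_5$, the path $P_5$, the star $K_{1,n-1}$, and the double star $S_{p,1}$.
   Context: A maximum matching is a matching of largest possible size. $C_5$, $P_5$ are the cycle and path on five vertices; $K_{1,n-1}$ is the star with $n-1$ edges; the double star $S_{p,1}$ is the tree consisting of two adjacent vertices $v,u$ where $v$ has $p$ further leaf neighbors and $u$ has one further leaf neighbor. For a proper edge coloring $c:E(G)\to\{1,\dots,k\}$ of $G$, let $\pi=(\mathcal{C}_1,\dots,\mathcal{C}_k)$ be the ordered partition of $E(G)$ into color classes. For a vertex $v$ and an edge $e=xy$, $d(v,e)=\min\{d(v,x),d(v,y)\}$, and $d(v,\mathcal{C}_i)=\min\{d(v,e): e\in\mathcal{C}_i\}$. The edge color code of $v$ is $c_\pi(v)=(d(v,\mathcal{C}_1),\dots,d(v,\mathcal{C}_k))$. The coloring is an edge-locating coloring if distinct vertices have distinct edge color codes; $\chi'_L(G)$ is the minimum number of colors in an edge-locating coloring of $G$. -}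

module Defs where

open import Data.Nat using (ℕ; zero; suc; _≤_; _<_; _⊓_; _≡ᵇ_; _<ᵇ_; _%_; _∸_; _+_)
open import Data.Fin using (Fin; toℕ)
open import Data.Bool using (Bool; true; false; _∧_; _∨_; _xor_)
open import Data.List using (List; length; allFin; cartesianProduct; filterᵇ)
open import Data.List.Relation.Unary.AllPairs using (AllPairs)
open import Data.Product using (Σ; ∃-syntax; _×_; proj₁; proj₂; _,_)
open import Data.Sum using (_⊎_)
open import Relation.Nullary using (¬_)
open import Relation.Binary.PropositionalEquality using (_≡_; _≢_)

Adj : ℕ → Set
Adj n = Fin n → Fin n → Bool

module _ {n : ℕ} (G : Adj n) where

  IsSimple : Set
  IsSimple = (∀ u v → G u v ≡ G v u) × (∀ v → G v v ≡ false)

  data Walk : Fin n → Fin n → ℕ → Set where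
    nil  : ∀ {u} → Walk u u 0
    cons : ∀ {u w v ℓ} → G u w ≡ true → Walk w v ℓ → Walk u v (suc ℓ)

  IsConnected : Set
  IsConnected = ∀ u v → ∃[ ℓ ] Walk u v ℓ

  IsDist : Fin n → Fin n → ℕ → Set
  IsDist u v d = Walk u v d × (∀ ℓ → Walk u v ℓ → d ≤ ℓ)

  record Edge : Set where
    constructor edge
    field
      x   : Fin n
      y   : Fin n
      x<y : toℕ x < toℕ y
      adj : G x y ≡ true
  open Edge public

  SameEdge : Edge → Edge → Set
  SameEdge e f = x e ≡ x f × y e ≡ y f

  Incident : Edge → Edge → Set
  Incident e f = x e ≡ x f ⊎ x e ≡ y f ⊎ y e ≡ x f ⊎ y e ≡ y f

  edgePairs : List (Fin n × Fin n)
  edgePairs = filterᵇ (λ p → (toℕ (proj₁ p) <ᵇ toℕ (proj₂ p)) ∧ G (proj₁ p) (proj₂ p))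
                      (cartesianProduct (allFin n) (allFin n))

  size : ℕ
  size = length edgePairs

  IsMatching : List Edge → Set
  IsMatching M = AllPairs (λ e f → ¬ Incident e f) M

  HasMaximumMatchingOfSize : ℕ → Set
  HasMaximumMatchingOfSize k =
    Σ (List Edge) λ M → IsMatching M × length M ≡ k ×
      (∀ M' → IsMatching M' → length M' ≤ k)

  module _ {k : ℕ} (c : Edge → Fin k) where

    IsProperEdgeColoring : Set
    IsProperEdgeColoring = ∀ e f → ¬ SameEdge e f → Incident e f → c e ≢ c f

    DistVE : Fin n → Edge → ℕ → Set
    DistVE v e d = ∃[ dx ] ∃[ dy ] IsDist v (x e) dx × IsDist v (y e) dy × d ≡ dx ⊓ dy

    -- d(v, C_i) = d : minimum of d(v,e) over edges e of colour i
    -- (no such d exists when C_i is empty, i.e. the distance is ∞)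
    DistVC : Fin n → Fin k → ℕ → Set
    DistVC v i d = (∃[ e ] c e ≡ i × DistVE v e d) ×
                   (∀ e d' → c e ≡ i → DistVE v e d' → d ≤ d')

    IsEdgeLocating : Set
    IsEdgeLocating = IsProperEdgeColoring ×
      (∀ u v → u ≢ v → ∃[ i ] ∃[ du ] ∃[ dv ]
          DistVC u i du × DistVC v i dv × du ≢ dv)

  EdgeLocatingColorable : ℕ → Set
  EdgeLocatingColorable k = Σ (Edge → Fin k) IsEdgeLocating

  IsChiL : ℕ → Set
  IsChiL χ = EdgeLocatingColorable χ × (∀ j → j < χ → ¬ EdgeLocatingColorable j)

  AttainsBound : Set
  AttainsBound = ∀ k → HasMaximumMatchingOfSize k → IsChiL (size ∸ k + 1)

symClose : ∀ {n} → Adj n → Adj n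
symClose B i j = B i j ∨ B j i

C5 : Adj 5
C5 = symClose λ i j → toℕ j ≡ᵇ (suc (toℕ i) % 5)

P5 : Adj 5
P5 = symClose λ i j → toℕ j ≡ᵇ suc (toℕ i)

star : ∀ n → Adj n
star n i j = (toℕ i ≡ᵇ 0) xor (toℕ j ≡ᵇ 0)

-- double star S_{p,1} on p+3 vertices: v = 0, u = 1, leaf of u = 2,
-- leaves of v = 3, …, p+2
doubleStar : ∀ p → Adj (p + 3)
doubleStar p = symClose λ i j →
  ((toℕ i ≡ᵇ 0) ∧ (toℕ j ≡ᵇ 1)) ∨ ((toℕ i ≡ᵇ 1) ∧ (toℕ j ≡ᵇ 2)) ∨
  ((toℕ i ≡ᵇ 0) ∧ (2 <ᵇ toℕ j))

{-# OPTIONS --safe #-}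
-- Give all edges of a matching M one common colour and every other edge a colour of its own:
-- this is proper, and uses at most m − |M| + 1 colours.  Two vertices u ≠ v are told apart by
-- the colour of an unmatched edge at u missing v (distance 0 versus ≥ 1), or by the matching
-- colour when only u is covered.  Otherwise every unmatched edge at u or at v joins u and v, so
-- u, v and their partners on the matching form a set of at most four vertices that is closed
-- under adjacency (impossible when G is connected with n ≥ 5), unless a partner u′ of u has a
-- neighbour w off the matching edges at u and v; the edge u′w is then at distance ≤ 1 from u
-- but ≥ 2 from v.
--
-- Attainment: the matching number of each extremal graph is witnessed by an explicit matching;
-- stars and double stars need as many colours as their maximum degree, and for C₅ and P₅ every
-- colouring with one colour fewer is refuted by exhaustive search.
module Submission where

open import Defs
open import Data.Nat using (ℕ; _≤_; _∸_; _+_; zero; suc; _<_; _⊓_; z≤n; s≤s; _≤?_; _<ᵇ_; _≡ᵇ_; ∣_-_∣)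
open import Data.Product using (_×_; ∃-syntax; proj₁; proj₂; _,_)

import Data.Nat.Properties as ℕ
open import Data.Fin using (Fin; toℕ; zero; suc; _≟_; inject≤) renaming (_<_ to _<ᶠ_)
import Data.Fin.Properties as Fin
open import Data.Bool using (Bool; true; false; _∧_; _∨_; T)
import Data.Bool.Properties as Bool
open import Data.Bool.Properties using (T-∧; T-≡)
open import Data.Sum using (_⊎_; inj₁; inj₂; [_,_]′)
open import Data.Empty using (⊥-elim)
open import Data.List using (List; []; _∷_; length; filter; lookup; upTo; allFin; cartesianProduct)
open import Data.List.Properties using (length-tabulate)
open import Data.List.Relation.Unary.All as All using (All; []; _∷_)
open import Data.List.Relation.Unary.All.Properties using (all-filter)
open import Data.List.Relation.Unary.Any as Any using (here; there; any?)
open import Data.List.Relation.Unary.Any.Properties using (lookup-index)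
open import Data.List.Relation.Unary.AllPairs as AllPairs using (AllPairs; []; _∷_)
open import Data.List.Relation.Unary.Unique.Propositional using (Unique)
open import Data.List.Relation.Unary.Unique.Propositional.Properties
  using (allFin⁺; filter⁺; cartesianProduct⁺)
open import Data.List.Membership.Propositional using (_∈_; _∉_)
open import Data.List.Membership.Propositional.Properties
  using (∈-lookup; ∈-filter⁺; ∈-filter⁻; ∈-upTo⁺; ∈-allFin; ∈-cartesianProduct⁺)
import Data.List.Membership.DecPropositional
import Data.List.Extrema ℕ.≤-totalOrder as Extrema
open import Data.Vec using (Vec; []; _∷_; tabulate) renaming (lookup to lookupᵛ)
open import Data.Vec.Properties using (lookup∘tabulate)
open import Function using (_∘_; id; Equivalence; case_of_)
open import Relation.Nullary using (¬_; Dec; yes; no; ¬?; _⊎-dec_; _×-dec_; _→-dec_)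
open import Relation.Nullary.Decidable using (map′; T?; from-yes)
open import Relation.Binary using (tri<; tri≈; tri>)
open import Relation.Binary.PropositionalEquality
  using (_≡_; _≢_; refl; sym; trans; cong; cong₂; subst; module ≡-Reasoning)
open import Axiom.UniquenessOfIdentityProofs using (module Decidable⇒UIP)

open Equivalence using (to; from)

module _ {A : Set} {Q : A → Set} (Q? : ∀ a → Dec (Q a)) (f : A → ℕ) where

  argmin-satisfying : ∀ {a} xs → Q a →
    ∃[ b ] Q b × f b ≤ f a × (∀ {z} → z ∈ xs → Q z → f b ≤ f z)
  argmin-satisfying {a} xs qa =
    Extrema.argmin f a ys ,
    Extrema.argmin-all f {xs = ys} qa (All.tabulate (proj₂ ∘ ∈-filter⁻ Q? {xs = xs})) ,
    Extrema.f[argmin]≤f[⊤] {f = f} a ys ,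
    λ z∈xs qz → All.lookup (Extrema.f[argmin]≤f[xs] {f = f} a ys) (∈-filter⁺ Q? z∈xs qz)
    where ys = filter Q? xs

allPairs-lookup : ∀ {A : Set} {R : A → A → Set} {xs : List A} → AllPairs R xs →
  ∀ {i j : Fin (length xs)} → i <ᶠ j → R (lookup xs i) (lookup xs j)
allPairs-lookup (p ∷ ps) {zero}  {suc j} _         = All.lookup p (∈-lookup j)
allPairs-lookup (p ∷ ps) {suc i} {suc j} (s≤s i<j) = allPairs-lookup ps i<j

unique-length≤ : ∀ {A : Set} {m} {xs : List A} (f : Fin m → A) → Unique xs →
  (∀ {z} → z ∈ xs → ∃[ t ] z ≡ f t) → length xs ≤ m
unique-length≤ {m = m} {xs} f uniq cover with length xs ≤? m
... | yes le = le
... | no gt with i , j , i<j , same ← Fin.pigeonhole (ℕ.≰⇒> gt) (proj₁ ∘ cover ∘ ∈-lookup) =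
  ⊥-elim (allPairs-lookup uniq i<j
    (trans (proj₂ (cover (∈-lookup i))) (trans (cong f same) (sym (proj₂ (cover (∈-lookup j)))))))

length-filter+length-filter-∁ : ∀ {A : Set} {P : A → Set} (P? : ∀ a → Dec (P a)) xs →
  length (filter P? xs) + length (filter (¬? ∘ P?) xs) ≡ length xs
length-filter+length-filter-∁ P? [] = refl
length-filter+length-filter-∁ P? (z ∷ zs) with P? z
... | yes _ = cong suc (length-filter+length-filter-∁ P? zs)
... | no  _ = trans (ℕ.+-suc _ _) (cong suc (length-filter+length-filter-∁ P? zs))

∀-vec? : ∀ {k m} {P : Vec (Fin k) m → Set} → (∀ as → Dec (P as)) → Dec (∀ as → P as)
∀-vec? {m = zero}  P? = map′ (λ p → λ { [] → p }) (λ ∀p → ∀p []) (P? [])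
∀-vec? {m = suc m} P? = map′ (λ ∀p → λ { (a ∷ as) → ∀p a as }) (λ ∀p a as → ∀p (a ∷ as))
  (Fin.all? λ a → ∀-vec? λ as → P? (a ∷ as))

module Graph {n : ℕ} (G : Adj n) where

  simple? : Dec (IsSimple G)
  simple? = (Fin.all? λ u → Fin.all? λ v → G u v Bool.≟ G v u) ×-dec
            (Fin.all? λ v → G v v Bool.≟ false)

  walk₀⇒≡ : ∀ {u v} → Walk G u v 0 → u ≡ v
  walk₀⇒≡ nil = refl

  walk₁⇒adj : ∀ {u v} → Walk G u v 1 → G u v ≡ true
  walk₁⇒adj (cons g nil) = g

  walk-++ : ∀ {a b c ℓ ℓ′} → Walk G a b ℓ → Walk G b c ℓ′ → Walk G a c (ℓ + ℓ′)
  walk-++ nil        q = q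
  walk-++ (cons g p) q = cons g (walk-++ p q)

  connected-via : ∀ z → (∀ a → ∃[ ℓ ] Walk G a z ℓ) → (∀ a → ∃[ ℓ ] Walk G z a ℓ) → IsConnected G
  connected-via z to from u v = _ , walk-++ (proj₂ (to u)) (proj₂ (from v))

  walk? : ∀ ℓ u v → Dec (Walk G u v ℓ)
  walk? zero    u v = map′ (λ { refl → nil }) walk₀⇒≡ (u ≟ v)
  walk? (suc ℓ) u v = map′ (λ (w , g , p) → cons g p) (λ { (cons g p) → _ , g , p })
    (Fin.any? λ w → (G u w Bool.≟ true) ×-dec walk? ℓ w v)

  isDist? : ∀ u v d → Dec (IsDist G u v d)
  isDist? u v d = map′ (λ p → proj₁ p , λ ℓ wℓ → ℕ.≮⇒≥ λ ℓ<d → proj₂ p ℓ<d wℓ)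
                       (λ p → proj₁ p , λ {ℓ} ℓ<d wℓ → ℕ.<⇒≱ ℓ<d (proj₂ p ℓ wℓ))
    (walk? d u v ×-dec ℕ.allUpTo? (λ ℓ → ¬? (walk? ℓ u v)) d)

  shortest-walk : IsConnected G → ∀ u v → ∃[ d ] IsDist G u v d
  shortest-walk conn u v with L , w ← conn u v
    with d , wd , d≤L , least ← argmin-satisfying (λ ℓ → walk? ℓ u v) id (upTo (suc L)) w =
    d , wd , bound
    where
    bound : ∀ ℓ → Walk G u v ℓ → d ≤ ℓ
    bound ℓ wℓ with ℓ ≤? L
    ... | yes ℓ≤L = least (∈-upTo⁺ (s≤s ℓ≤L)) wℓ
    ... | no  ℓ≰L = ℕ.≤-trans d≤L (ℕ.<⇒≤ (ℕ.≰⇒> ℓ≰L))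

  isDist-unique : ∀ {u v d d′} → IsDist G u v d → IsDist G u v d′ → d ≡ d′
  isDist-unique (w , least) (w′ , least′) = ℕ.≤-antisym (least _ w′) (least′ _ w)

  isDist-refl : ∀ u → IsDist G u u 0
  isDist-refl u = nil , λ _ _ → z≤n

  isDist-adj : ∀ {u v d} → G u v ≡ true → IsDist G u v d → d ≤ 1
  isDist-adj g (_ , least) = least 1 (cons g nil)

  isDist-pos : ∀ {u v d} → u ≢ v → IsDist G u v d → 1 ≤ d
  isDist-pos {d = zero}  u≢v (w , _) = ⊥-elim (u≢v (walk₀⇒≡ w))
  isDist-pos {d = suc d} _   _       = s≤s z≤n

  isDist-nonadj : ∀ {u v d} → u ≢ v → G u v ≢ true → IsDist G u v d → 2 ≤ d
  isDist-nonadj {d = zero}        u≢v _ (w , _) = ⊥-elim (u≢v (walk₀⇒≡ w))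
  isDist-nonadj {d = suc zero}    _ ¬g (w , _)  = ⊥-elim (¬g (walk₁⇒adj w))
  isDist-nonadj {d = suc (suc d)} _ _ _         = s≤s (s≤s z≤n)

  data _∈ᵉ_ (u : Fin n) (e : Edge G) : Set where
    at-x : u ≡ x e → u ∈ᵉ e
    at-y : u ≡ y e → u ∈ᵉ e

  _∈ᵉ?_ : ∀ u e → Dec (u ∈ᵉ e)
  u ∈ᵉ? e = map′ [ at-x , at-y ]′ (λ { (at-x p) → inj₁ p ; (at-y q) → inj₂ q })
                 ((u ≟ x e) ⊎-dec (u ≟ y e))

  x≢y : ∀ e → x e ≢ y e
  x≢y e eq = ℕ.<-irrefl (cong toℕ eq) (x<y {G = G} e)

  edge-≡ : ∀ {e f : Edge G} → x e ≡ x f → y e ≡ y f → e ≡ f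
  edge-≡ {edge a b _ _} {edge .a .b _ _} refl refl =
    cong₂ (edge a b) (ℕ.<-irrelevant _ _) (Decidable⇒UIP.≡-irrelevant Bool._≟_ _ _)

  _≟ᵉ_ : (e f : Edge G) → Dec (e ≡ f)
  e ≟ᵉ f with x e ≟ x f | y e ≟ y f
  ... | yes p | yes q = yes (edge-≡ p q)
  ... | no ¬p | _     = no λ { refl → ¬p refl }
  ... | yes _ | no ¬q = no λ { refl → ¬q refl }

  incident? : ∀ e f → Dec (Incident G e f)
  incident? e f = (x e ≟ x f) ⊎-dec (x e ≟ y f) ⊎-dec (y e ≟ x f) ⊎-dec (y e ≟ y f)

  matching? : ∀ L → Dec (IsMatching G L)
  matching? = AllPairs.allPairs? λ e f → ¬? (incident? e f)

  shared⇒incident : ∀ {u e f} → u ∈ᵉ e → u ∈ᵉ f → Incident G e f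
  shared⇒incident (at-x p) (at-x q) = inj₁ (trans (sym p) q)
  shared⇒incident (at-x p) (at-y q) = inj₂ (inj₁ (trans (sym p) q))
  shared⇒incident (at-y p) (at-x q) = inj₂ (inj₂ (inj₁ (trans (sym p) q)))
  shared⇒incident (at-y p) (at-y q) = inj₂ (inj₂ (inj₂ (trans (sym p) q)))

  incident-refl : ∀ e → Incident G e e
  incident-refl e = inj₁ refl

  incident-sym : ∀ {e f} → Incident G e f → Incident G f e
  incident-sym (inj₁ p)                 = inj₁ (sym p)
  incident-sym (inj₂ (inj₁ p))          = inj₂ (inj₂ (inj₁ (sym p)))
  incident-sym (inj₂ (inj₂ (inj₁ p)))   = inj₂ (inj₁ (sym p))
  incident-sym (inj₂ (inj₂ (inj₂ p)))   = inj₂ (inj₂ (inj₂ (sym p)))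

  endpoint-cases : ∀ {a b z e} → a ∈ᵉ e → b ∈ᵉ e → a ≢ b → z ∈ᵉ e → z ≡ a ⊎ z ≡ b
  endpoint-cases (at-x p) (at-x q) a≢b _        = ⊥-elim (a≢b (trans p (sym q)))
  endpoint-cases (at-y p) (at-y q) a≢b _        = ⊥-elim (a≢b (trans p (sym q)))
  endpoint-cases (at-x p) (at-y q) _   (at-x r) = inj₁ (trans r (sym p))
  endpoint-cases (at-x p) (at-y q) _   (at-y r) = inj₂ (trans r (sym q))
  endpoint-cases (at-y p) (at-x q) _   (at-x r) = inj₂ (trans r (sym q))
  endpoint-cases (at-y p) (at-x q) _   (at-y r) = inj₁ (trans r (sym p))

  other-endpoint : ∀ {a e} → a ∈ᵉ e → ∃[ a′ ] a′ ∈ᵉ e × a′ ≢ a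
  other-endpoint {e = e} (at-x refl) = y e , at-y refl , x≢y e ∘ sym
  other-endpoint {e = e} (at-y refl) = x e , at-x refl , x≢y e

  matching-incident⇒≡ : ∀ {L} → IsMatching G L → ∀ {e f} → e ∈ L → f ∈ L → Incident G e f → e ≡ f
  matching-incident⇒≡ (_  ∷ _)  (here refl) (here refl) _   = refl
  matching-incident⇒≡ (p  ∷ _)  (here refl) (there f∈L) inc = ⊥-elim (All.lookup p f∈L inc)
  matching-incident⇒≡ (p  ∷ _)  {e} {f} (there e∈L) (here refl) inc =
    ⊥-elim (All.lookup p e∈L (incident-sym {e} {f} inc))
  matching-incident⇒≡ (_  ∷ ps) (there e∈L) (there f∈L) inc = matching-incident⇒≡ ps e∈L f∈L inc

  matching⇒unique : ∀ {L} → IsMatching G L → Unique L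
  matching⇒unique = AllPairs.map λ { {e} ¬inc refl → ¬inc (incident-refl e) }

  IsEdgePair : Fin n × Fin n → Bool
  IsEdgePair p = (toℕ (proj₁ p) <ᵇ toℕ (proj₂ p)) ∧ G (proj₁ p) (proj₂ p)

  pair⇒edge : ∀ {a b} → T (IsEdgePair (a , b)) → Edge G
  pair⇒edge {a} {b} t = edge a b (ℕ.<ᵇ⇒< (toℕ a) (toℕ b) (proj₁ (to (T-∧ {toℕ a <ᵇ toℕ b}) t)))
                                 (to T-≡ (proj₂ (to (T-∧ {toℕ a <ᵇ toℕ b}) t)))

  edge⇒pair : ∀ e → T (IsEdgePair (x e , y e))
  edge⇒pair e = from T-∧ (ℕ.<⇒<ᵇ (x<y {G = G} e) , from T-≡ (adj e))

  mkEdge : ∀ a b → {T (IsEdgePair (a , b))} → Edge G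
  mkEdge a b {t} = pair⇒edge t

  Enumerates : ∀ {m} → (Fin m → Edge G) → Set
  Enumerates L = ∀ a b → T (IsEdgePair (a , b)) → ∃[ t ] x (L t) ≡ a × y (L t) ≡ b

  enumerates? : ∀ {m} (L : Fin m → Edge G) → Dec (Enumerates L)
  enumerates? L = Fin.all? λ a → Fin.all? λ b → T? (IsEdgePair (a , b)) →-dec
    Fin.any? λ t → (x (L t) ≟ a) ×-dec (y (L t) ≟ b)

  enumerates⇒cover : ∀ {m} {L : Fin m → Edge G} → Enumerates L → ∀ e → ∃[ t ] e ≡ L t
  enumerates⇒cover enum e =
    let t , p , q = enum (x e) (y e) (edge⇒pair e) in t , edge-≡ (sym p) (sym q)

  edgesOf : ∀ ps → All (T ∘ IsEdgePair) ps → List (Edge G)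
  edgesOf []       []       = []
  edgesOf (_ ∷ ps) (t ∷ ts) = pair⇒edge t ∷ edgesOf ps ts

  length-edgesOf : ∀ ps ts → length (edgesOf ps ts) ≡ length ps
  length-edgesOf []       []       = refl
  length-edgesOf (_ ∷ ps) (_ ∷ ts) = cong suc (length-edgesOf ps ts)

  ∈-edgesOf : ∀ {e} ps ts → (x e , y e) ∈ ps → e ∈ edgesOf ps ts
  ∈-edgesOf (_ ∷ ps) (t ∷ ts) (here refl) = here (edge-≡ refl refl)
  ∈-edgesOf (_ ∷ ps) (t ∷ ts) (there p)   = there (∈-edgesOf ps ts p)

  edges : List (Edge G)
  edges = edgesOf (edgePairs G) (all-filter (T? ∘ IsEdgePair) pairs)
    where pairs = cartesianProduct (allFin n) (allFin n)

  length-edges : length edges ≡ size G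
  length-edges = length-edgesOf (edgePairs G) _

  ∈-edges : ∀ e → e ∈ edges
  ∈-edges e = ∈-edgesOf (edgePairs G) _
    (∈-filter⁺ (T? ∘ IsEdgePair) (∈-cartesianProduct⁺ (∈-allFin (x e)) (∈-allFin (y e))) (edge⇒pair e))

  size≤ : ∀ {m} (L : Fin m → Edge G) → (∀ e → ∃[ t ] e ≡ L t) → size G ≤ m
  size≤ L cover = unique-length≤ (λ t → x (L t) , y (L t))
    (filter⁺ (T? ∘ IsEdgePair) (cartesianProduct⁺ (allFin⁺ n) (allFin⁺ n)))
    λ z∈ → let t , e≡Lt = cover (pair⇒edge (proj₂ (∈-filter⁻ (T? ∘ IsEdgePair) {xs = pairs} z∈)))
           in t , cong₂ _,_ (cong x e≡Lt) (cong y e≡Lt)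
    where pairs = cartesianProduct (allFin n) (allFin n)

  ∃ᵉ? : {P : Edge G → Set} → (∀ e → Dec (P e)) → Dec (∃[ e ] P e)
  ∃ᵉ? P? = map′ Any.satisfied (λ (e , p) → Any.map (λ { refl → p }) (∈-edges e)) (any? P? edges)

  module Simple (simple : IsSimple G) where

    adj⇒≢ : ∀ {a b} → G a b ≡ true → a ≢ b
    adj⇒≢ {a} g refl with () ← trans (sym g) (proj₂ simple a)

    endpoints-adj : ∀ {a b e} → a ∈ᵉ e → b ∈ᵉ e → a ≢ b → G a b ≡ true
    endpoints-adj (at-x refl) (at-x refl) a≢b = ⊥-elim (a≢b refl)
    endpoints-adj {e = e} (at-x refl) (at-y refl) _ = adj e
    endpoints-adj {e = e} (at-y refl) (at-x refl) _ = trans (proj₁ simple _ _) (adj e)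
    endpoints-adj (at-y refl) (at-y refl) a≢b = ⊥-elim (a≢b refl)

    edge-of-adj : ∀ {a b} → G a b ≡ true → ∃[ f ] a ∈ᵉ f × b ∈ᵉ f
    edge-of-adj {a} {b} g with ℕ.<-cmp (toℕ a) (toℕ b)
    ... | tri< a<b _ _ = edge a b a<b g , at-x refl , at-y refl
    ... | tri≈ _ a≡b _ = ⊥-elim (adj⇒≢ g (Fin.toℕ-injective a≡b))
    ... | tri> _ _ b<a = edge b a b<a (trans (proj₁ simple b a) g) , at-y refl , at-x refl

  Distinguishes : ∀ {k} → (Edge G → Fin k) → Fin n → Fin n → Set
  Distinguishes c u v = ∃[ i ] ∃[ du ] ∃[ dv ] DistVC G c u i du × DistVC G c v i dv × du ≢ dv

  distinguishes-sym : ∀ {k} {c : Edge G → Fin k} {u v} → Distinguishes c u v → Distinguishes c v u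
  distinguishes-sym (i , du , dv , pu , pv , du≢dv) = i , dv , du , pv , pu , du≢dv ∘ sym

  module Connected (conn : IsConnected G) where

    dist : Fin n → Fin n → ℕ
    dist u v = proj₁ (shortest-walk conn u v)

    dist-isDist : ∀ u v → IsDist G u v (dist u v)
    dist-isDist u v = proj₂ (shortest-walk conn u v)

    closed⇒complete : (S : List (Fin n)) → (∀ {a b} → a ∈ S → G a b ≡ true → b ∈ S) →
                      ∀ {a₀} → a₀ ∈ S → ∀ a → a ∈ S
    closed⇒complete S closed a₀∈S a = along (proj₂ (conn _ a)) a₀∈S
      where
      along : ∀ {a b ℓ} → Walk G a b ℓ → a ∈ S → b ∈ S
      along nil        a∈S = a∈S
      along (cons g w) a∈S = along w (closed a∈S g)

    no-small-closed-set : (S : List (Fin n)) → length S < n →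
                          (∀ {a b} → a ∈ S → G a b ≡ true → b ∈ S) → ∀ {a} → ¬ a ∈ S
    no-small-closed-set S small closed a∈S = ℕ.<⇒≱ small
      (ℕ.≤-trans (ℕ.≤-reflexive (sym (length-tabulate {n = n} id)))
        (unique-length≤ (lookup S) (allFin⁺ n)
          λ {z} _ → Any.index (complete z) , lookup-index (complete z)))
      where complete = closed⇒complete S closed a∈S

    dist-edge : Fin n → Edge G → ℕ
    dist-edge v e = dist v (x e) ⊓ dist v (y e)

    module _ {k} (c : Edge G → Fin k) where

      DistVE-dist-edge : ∀ v e → DistVE G c v e (dist-edge v e)
      DistVE-dist-edge v e = _ , _ , dist-isDist v (x e) , dist-isDist v (y e) , refl

      DistVE-unique : ∀ {v e d} → DistVE G c v e d → d ≡ dist-edge v e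
      DistVE-unique {v} {e} (_ , _ , dx , dy , refl) =
        cong₂ _⊓_ (isDist-unique dx (dist-isDist v (x e))) (isDist-unique dy (dist-isDist v (y e)))

      DistVC-exists : ∀ v i → (∃[ e ] c e ≡ i) → ∃[ d ] DistVC G c v i d
      DistVC-exists v i (e₀ , ce₀) =
        let e , ce , _ , least = argmin-satisfying (λ e → c e ≟ i) (dist-edge v) edges ce₀
        in dist-edge v e , (e , ce , DistVE-dist-edge v e) ,
           λ f d cf dve →
             subst (dist-edge v e ≤_) (sym (DistVE-unique {v} {f} dve)) (least (∈-edges f) cf)

      DistVC-≤ : ∀ {u w e d} → w ∈ᵉ e → DistVC G c u (c e) d → d ≤ dist u w
      DistVC-≤ {u} {e = e} w∈e (_ , least) =
        ℕ.≤-trans (least e _ refl (DistVE-dist-edge u e)) (endpoint w∈e)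
        where
        endpoint : ∀ {w} → w ∈ᵉ e → dist-edge u e ≤ dist u w
        endpoint (at-x refl) = ℕ.m⊓n≤m _ _
        endpoint (at-y refl) = ℕ.m⊓n≤n _ _

      DistVC-≥ : ∀ {v i d} r → (∀ f → c f ≡ i → ∀ {z d′} → z ∈ᵉ f → IsDist G v z d′ → r ≤ d′) →
                 DistVC G c v i d → r ≤ d
      DistVC-≥ r far ((f , cf , _ , _ , px , py , refl) , _) =
        ℕ.⊓-glb (far f cf (at-x refl) px) (far f cf (at-y refl) py)

      distinguish-by : ∀ {u v} e r → (∀ {du} → DistVC G c u (c e) du → du ≤ r) →
                       (∀ {dv} → DistVC G c v (c e) dv → r < dv) → Distinguishes c u v
      distinguish-by {u} {v} e r near far =
        let du , pu = DistVC-exists u (c e) (e , refl)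
            dv , pv = DistVC-exists v (c e) (e , refl)
        in c e , du , dv , pu , pv ,
           λ du≡dv → ℕ.<-irrefl refl (ℕ.≤-<-trans (near pu) (subst (r <_) (sym du≡dv) (far pv)))

      distinguish-by-endpoint : ∀ {u v e} → u ∈ᵉ e → (∀ f → c f ≡ c e → ¬ v ∈ᵉ f) → Distinguishes c u v
      distinguish-by-endpoint {u} {v} u∈e v∉ = distinguish-by _ 0
        (λ pu → subst (_ ≤_) (isDist-unique (dist-isDist u u) (isDist-refl u)) (DistVC-≤ u∈e pu))
        (DistVC-≥ 1 λ f cf z∈f → isDist-pos λ { refl → v∉ f cf z∈f })

      distinguish-by-neighbour : ∀ {u v w e} → w ∈ᵉ e → G u w ≡ true →
        (∀ f → c f ≡ c e → ∀ {z} → z ∈ᵉ f → v ≢ z × G v z ≢ true) → Distinguishes c u v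
      distinguish-by-neighbour {u} {w = w} w∈e g far = distinguish-by _ 1
        (λ pu → ℕ.≤-trans (DistVC-≤ w∈e pu) (isDist-adj g (dist-isDist u w)))
        (DistVC-≥ 2 λ f cf z∈f → isDist-nonadj (proj₁ (far f cf z∈f)) (proj₂ (far f cf z∈f)))

EdgeLocatingColorable-mono : ∀ {n} {G : Adj n} {a b} → a ≤ b →
  EdgeLocatingColorable G a → EdgeLocatingColorable G b
EdgeLocatingColorable-mono {G = G} {a} {b} a≤b (c , proper , locates) =
  inject ∘ c , (λ e f e≠f inc same → proper e f e≠f inc (inject-injective same)) ,
  λ u v u≢v → let i , du , dv , pu , pv , du≢dv = locates u v u≢v
              in inject i , du , dv , lift pu , lift pv , du≢dv
  where
  inject : Fin a → Fin b
  inject i = inject≤ i a≤b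

  inject-injective : ∀ {i j} → inject i ≡ inject j → i ≡ j
  inject-injective = Fin.inject≤-injective a≤b a≤b _ _

  lift : ∀ {u i d} → DistVC G c u i d → DistVC G (inject ∘ c) u (inject i) d
  lift ((e , ce , dve) , least) =
    (e , cong inject ce , dve) , λ e′ d′ ce′ → least e′ d′ (inject-injective ce′)

-- The upper bound

module MatchingColouring {n : ℕ} (G : Adj n) (n≥5 : 5 ≤ n) (simple : IsSimple G)
                         (conn : IsConnected G) (M : List (Edge G)) (matching : IsMatching G M) where
  open Graph G
  open Simple simple
  open Connected conn
  open Data.List.Membership.DecPropositional _≟ᵉ_ using (_∈?_)

  unmatched : List (Edge G)
  unmatched = filter (λ e → ¬? (e ∈? M)) edges

  colours : ℕ
  colours = suc (length unmatched)

  colourOf : ∀ e → Dec (e ∈ M) → Fin colours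
  colourOf e (yes _)   = zero
  colourOf e (no  e∉M) = suc (Any.index (∈-filter⁺ (λ e → ¬? (e ∈? M)) (∈-edges e) e∉M))

  colour : Edge G → Fin colours
  colour e = colourOf e (e ∈? M)

  colour-matched : ∀ {e} → e ∈ M → colour e ≡ zero
  colour-matched {e} e∈M with e ∈? M
  ... | yes _   = refl
  ... | no  e∉M = ⊥-elim (e∉M e∈M)

  colour-zero : ∀ {e} → colour e ≡ zero → e ∈ M
  colour-zero {e} _ with e ∈? M
  ... | yes e∈M = e∈M

  colour-cases : ∀ {e f} → colour e ≡ colour f → (e ∈ M × f ∈ M) ⊎ e ≡ f
  colour-cases {e} {f} = cases (e ∈? M) (f ∈? M)
    where
    cases : (de : Dec (e ∈ M)) (df : Dec (f ∈ M)) → colourOf e de ≡ colourOf f df →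
            (e ∈ M × f ∈ M) ⊎ e ≡ f
    cases (yes e∈M) (yes f∈M) _  = inj₁ (e∈M , f∈M)
    cases (no  e∉M) (no  f∉M) eq = inj₂ (begin
      e                          ≡⟨ lookup-index (∈-filter⁺ _ (∈-edges e) e∉M) ⟩
      lookup unmatched _         ≡⟨ cong (lookup unmatched) (Fin.suc-injective eq) ⟩
      lookup unmatched _         ≡⟨ lookup-index (∈-filter⁺ _ (∈-edges f) f∉M) ⟨
      f                          ∎)
      where open ≡-Reasoning

  colour-proper : IsProperEdgeColoring G colour
  colour-proper e f e≠f inc same with colour-cases same
  ... | inj₁ (e∈M , f∈M) with refl ← matching-incident⇒≡ matching e∈M f∈M inc = e≠f (refl , refl)
  ... | inj₂ refl = e≠f (refl , refl)

  matched : List (Edge G)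
  matched = filter (_∈? M) edges

  length-M≤matched : length M ≤ length matched
  length-M≤matched = unique-length≤ (lookup matched) (matching⇒unique matching)
    λ e∈M → let p = ∈-filter⁺ (_∈? M) (∈-edges _) e∈M in Any.index p , lookup-index p

  colours-bound : colours ≤ size G ∸ length M + 1
  colours-bound = begin
    suc (length unmatched)                        ≡⟨ ℕ.+-comm 1 _ ⟩
    length unmatched + 1                          ≡⟨ cong (_+ 1) (ℕ.m+n∸n≡m _ (length M)) ⟨
    length unmatched + length M ∸ length M + 1    ≤⟨ ℕ.+-monoˡ-≤ 1 (ℕ.∸-monoˡ-≤ (length M) count) ⟩
    size G ∸ length M + 1                         ∎
    where
    open ℕ.≤-Reasoning
    count : length unmatched + length M ≤ size G
    count = begin
      length unmatched + length M        ≤⟨ ℕ.+-monoʳ-≤ (length unmatched) length-M≤matched ⟩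
      length unmatched + length matched  ≡⟨ ℕ.+-comm (length unmatched) _ ⟩
      length matched + length unmatched  ≡⟨ length-filter+length-filter-∁ (_∈? M) edges ⟩
      length edges                       ≡⟨ length-edges ⟩
      size G                             ∎

  Covered : Fin n → Set
  Covered u = ∃[ m ] m ∈ M × u ∈ᵉ m

  covered? : ∀ u → Dec (Covered u)
  covered? u = ∃ᵉ? λ m → (m ∈? M) ×-dec (u ∈ᵉ? m)

  FreeEdge : Fin n → Fin n → Set
  FreeEdge u v = ∃[ e ] e ∉ M × u ∈ᵉ e × ¬ v ∈ᵉ e

  free-edge? : ∀ u v → Dec (FreeEdge u v)
  free-edge? u v = ∃ᵉ? λ e → ¬? (e ∈? M) ×-dec (u ∈ᵉ? e) ×-dec ¬? (v ∈ᵉ? e)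

  FreeEdgesMeet : Fin n → Fin n → Set
  FreeEdgesMeet u v = ∀ e → e ∉ M → u ∈ᵉ e → v ∈ᵉ e

  ¬free-edge⇒meet : ∀ {u v} → ¬ FreeEdge u v → FreeEdgesMeet u v
  ¬free-edge⇒meet {u} {v} ¬free e e∉M u∈e with v ∈ᵉ? e
  ... | yes v∈e = v∈e
  ... | no  v∉e = ⊥-elim (¬free (e , e∉M , u∈e , v∉e))

  by-free-edge : ∀ {u v} → FreeEdge u v → Distinguishes colour u v
  by-free-edge (e , e∉M , u∈e , v∉e) = distinguish-by-endpoint colour u∈e λ f same v∈f →
    [ (λ (_ , e∈M) → e∉M e∈M) , (λ { refl → v∉e v∈f }) ]′ (colour-cases same)

  by-matching : ∀ {u v} → Covered u → ¬ Covered v → Distinguishes colour u v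
  by-matching (m , m∈M , u∈m) ¬covered = distinguish-by-endpoint colour u∈m λ f same v∈f →
    ¬covered (f , colour-zero (trans same (colour-matched m∈M)) , v∈f)

  neighbour-cases : ∀ {u v w} → FreeEdgesMeet u v → u ≢ v → G u w ≡ true →
                    (∃[ m ] m ∈ M × u ∈ᵉ m × w ∈ᵉ m) ⊎ w ≡ v
  neighbour-cases {u} {v} {w} meet u≢v g =
    let f , u∈f , w∈f = edge-of-adj g in
    case f ∈? M of λ where
      (yes f∈M) → inj₁ (f , f∈M , u∈f , w∈f)
      (no  f∉M) → case endpoint-cases u∈f (meet f f∉M u∈f) u≢v w∈f of λ where
        (inj₁ refl) → ⊥-elim (adj⇒≢ g refl)
        (inj₂ w≡v)  → inj₂ w≡v

  neighbour-of-matched : ∀ {u v w m} → m ∈ M → u ∈ᵉ m → FreeEdgesMeet u v → u ≢ v →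
                         G u w ≡ true → w ∈ᵉ m ⊎ w ≡ v
  neighbour-of-matched m∈M u∈m meet u≢v g with neighbour-cases meet u≢v g
  ... | inj₂ w≡v = inj₂ w≡v
  ... | inj₁ (m′ , m′∈M , u∈m′ , w∈m′)
    with refl ← matching-incident⇒≡ matching m′∈M m∈M (shared⇒incident u∈m′ u∈m) = inj₁ w∈m′

  via-partner : ∀ {u v mu mv u′ w} → u ≢ v → FreeEdgesMeet v u → mu ∈ M → mv ∈ M → mu ≢ mv →
                u ∈ᵉ mu → u′ ∈ᵉ mu → u′ ≢ u → v ∈ᵉ mv → G u′ w ≡ true → w ≢ u → ¬ w ∈ᵉ mv →
                Distinguishes colour u v
  via-partner {u} {v} {mu} {mv} {u′} {w} u≢v meet-v mu∈M mv∈M mu≢mv u∈mu u′∈mu u′≢u v∈mv g w≢u w∉mv =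
    distinguish-by-neighbour colour u′∈f (endpoints-adj u∈mu u′∈mu (u′≢u ∘ sym)) far
    where
    f = proj₁ (edge-of-adj g)
    u′∈f = proj₁ (proj₂ (edge-of-adj g))
    w∈f = proj₂ (proj₂ (edge-of-adj g))

    f∉M : f ∉ M
    f∉M f∈M with refl ← matching-incident⇒≡ matching f∈M mu∈M (shared⇒incident u′∈f u′∈mu) =
      [ w≢u , adj⇒≢ g ∘ sym ]′ (endpoint-cases u∈mu u′∈mu (u′≢u ∘ sym) w∈f)

    far-from-v : ∀ {z} → z ≢ u → ¬ z ∈ᵉ mv → v ≢ z × G v z ≢ true
    far-from-v z≢u z∉mv = (λ { refl → z∉mv v∈mv }) ,
      λ g′ → [ z∉mv , z≢u ]′ (neighbour-of-matched mv∈M v∈mv meet-v (u≢v ∘ sym) g′)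

    u′∉mv : ¬ u′ ∈ᵉ mv
    u′∉mv u′∈mv = mu≢mv (matching-incident⇒≡ matching mu∈M mv∈M (shared⇒incident u′∈mu u′∈mv))

    far : ∀ e → colour e ≡ colour f → ∀ {z} → z ∈ᵉ e → v ≢ z × G v z ≢ true
    far e same z∈e with colour-cases same
    ... | inj₁ (_ , f∈M) = ⊥-elim (f∉M f∈M)
    ... | inj₂ refl with endpoint-cases u′∈f w∈f (adj⇒≢ g) z∈e
    ... | inj₁ refl = far-from-v u′≢u u′∉mv
    ... | inj₂ refl = far-from-v w≢u w∉mv

  no-closed-pair : ∀ {u v} → ¬ (∀ {a b} → a ∈ u ∷ v ∷ [] → G a b ≡ true → b ∈ u ∷ v ∷ [])
  no-closed-pair closed =
    no-small-closed-set (_ ∷ _ ∷ []) (ℕ.≤-trans (s≤s (s≤s (s≤s z≤n))) n≥5) closed (here refl)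

  distinct-matching-edges : ∀ {u v mu mv u′ v′} → u ≢ v → FreeEdgesMeet u v → FreeEdgesMeet v u →
    mu ∈ M → mv ∈ M → mu ≢ mv → u ∈ᵉ mu → u′ ∈ᵉ mu → u′ ≢ u → v ∈ᵉ mv → v′ ∈ᵉ mv → v′ ≢ v →
    Distinguishes colour u v
  distinct-matching-edges {u} {v} {mu} {mv} {u′} {v′}
                          u≢v meet-u meet-v mu∈M mv∈M mu≢mv u∈mu u′∈mu u′≢u v∈mv v′∈mv v′≢v
    with Fin.any? (λ w → (G u′ w Bool.≟ true) ×-dec ¬? (w ≟ u) ×-dec ¬? (w ∈ᵉ? mv))
  ... | yes (w , g , w≢u , w∉mv) =
    via-partner u≢v meet-v mu∈M mv∈M mu≢mv u∈mu u′∈mu u′≢u v∈mv g w≢u w∉mv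
  ... | no no-exit-u
    with Fin.any? (λ w → (G v′ w Bool.≟ true) ×-dec ¬? (w ≟ v) ×-dec ¬? (w ∈ᵉ? mu))
  ... | yes (w , g , w≢v , w∉mu) = distinguishes-sym
    (via-partner (u≢v ∘ sym) meet-u mv∈M mu∈M (mu≢mv ∘ sym) v∈mv v′∈mv v′≢v u∈mu g w≢v w∉mu)
  ... | no no-exit-v = ⊥-elim (no-small-closed-set S n≥5 closed (here refl))
    where
    S = u ∷ u′ ∷ v ∷ v′ ∷ []

    in-mu : ∀ {b} → b ∈ᵉ mu → b ∈ S
    in-mu b∈mu = [ here , there ∘ here ]′ (endpoint-cases u∈mu u′∈mu (u′≢u ∘ sym) b∈mu)

    in-mv : ∀ {b} → b ∈ᵉ mv → b ∈ S
    in-mv b∈mv = [ there ∘ there ∘ here , there ∘ there ∘ there ∘ here ]′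
      (endpoint-cases v∈mv v′∈mv (v′≢v ∘ sym) b∈mv)

    closed : ∀ {a b} → a ∈ S → G a b ≡ true → b ∈ S
    closed (here refl) g =
      [ in-mu , there ∘ there ∘ here ]′ (neighbour-of-matched mu∈M u∈mu meet-u u≢v g)
    closed (there (there (here refl))) g =
      [ in-mv , here ]′ (neighbour-of-matched mv∈M v∈mv meet-v (u≢v ∘ sym) g)
    closed {b = b} (there (here refl)) g with b ≟ u | b ∈ᵉ? mv
    ... | yes refl | _        = here refl
    ... | no _     | yes b∈mv = in-mv b∈mv
    ... | no b≢u   | no b∉mv  = ⊥-elim (no-exit-u (b , g , b≢u , b∉mv))
    closed {b = b} (there (there (there (here refl)))) g with b ≟ v | b ∈ᵉ? mu
    ... | yes refl | _        = there (there (here refl))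
    ... | no _     | yes b∈mu = in-mu b∈mu
    ... | no b≢v   | no b∉mu  = ⊥-elim (no-exit-v (b , g , b≢v , b∉mu))

  both-covered : ∀ {u v} → u ≢ v → FreeEdgesMeet u v → FreeEdgesMeet v u → Covered u → Covered v →
                 Distinguishes colour u v
  both-covered {u} {v} u≢v meet-u meet-v (mu , mu∈M , u∈mu) (mv , mv∈M , v∈mv) with mu ≟ᵉ mv
  ... | no mu≢mv =
    let u′ , u′∈mu , u′≢u = other-endpoint u∈mu
        v′ , v′∈mv , v′≢v = other-endpoint v∈mv
    in distinct-matching-edges u≢v meet-u meet-v mu∈M mv∈M mu≢mv u∈mu u′∈mu u′≢u v∈mv v′∈mv v′≢v
  ... | yes refl = ⊥-elim (no-closed-pair closed)
    where
    in-mu : ∀ {b} → b ∈ᵉ mu → b ∈ u ∷ v ∷ []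
    in-mu b∈mu = [ here , there ∘ here ]′ (endpoint-cases u∈mu v∈mv u≢v b∈mu)

    closed : ∀ {a b} → a ∈ u ∷ v ∷ [] → G a b ≡ true → b ∈ u ∷ v ∷ []
    closed (here refl)         g = [ in-mu , there ∘ here ]′ (neighbour-of-matched mu∈M u∈mu meet-u u≢v g)
    closed (there (here refl)) g = [ in-mu , here ]′ (neighbour-of-matched mu∈M v∈mv meet-v (u≢v ∘ sym) g)

  colour-locates : ∀ u v → u ≢ v → Distinguishes colour u v
  colour-locates u v u≢v with free-edge? u v | free-edge? v u
  ... | yes free | _        = by-free-edge free
  ... | no _     | yes free = distinguishes-sym (by-free-edge free)
  ... | no ¬free-u | no ¬free-v with covered? u | covered? v
  ... | yes cu  | no ¬cv = by-matching cu ¬cv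
  ... | no ¬cu  | yes cv = distinguishes-sym (by-matching cv ¬cu)
  ... | yes cu  | yes cv = both-covered u≢v (¬free-edge⇒meet ¬free-u) (¬free-edge⇒meet ¬free-v) cu cv
  ... | no ¬cu  | no ¬cv = ⊥-elim (no-closed-pair closed)
    where
    only-neighbour : ∀ {a b w} → ¬ Covered a → ¬ FreeEdge a b → a ≢ b → G a w ≡ true → w ≡ b
    only-neighbour ¬ca ¬free a≢b g =
      [ (λ (m , m∈M , a∈m , _) → ⊥-elim (¬ca (m , m∈M , a∈m))) , id ]′
        (neighbour-cases (¬free-edge⇒meet ¬free) a≢b g)

    closed : ∀ {a b} → a ∈ u ∷ v ∷ [] → G a b ≡ true → b ∈ u ∷ v ∷ []
    closed (here refl)         g = there (here (only-neighbour ¬cu ¬free-u u≢v g))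
    closed (there (here refl)) g = here (only-neighbour ¬cv ¬free-v (u≢v ∘ sym) g)

  colour-locating : IsEdgeLocating G colour
  colour-locating = colour-proper , colour-locates

matching⇒edgeLocatingColorable : ∀ {n} (G : Adj n) → 5 ≤ n → IsSimple G → IsConnected G →
  ∀ M → IsMatching G M → EdgeLocatingColorable G (size G ∸ length M + 1)
matching⇒edgeLocatingColorable G n≥5 simple conn M matching =
  EdgeLocatingColorable-mono colours-bound (colour , colour-locating)
  where open MatchingColouring G n≥5 simple conn M matching

-- Attaining the bound

attains-bound : ∀ {n} (G : Adj n) → 5 ≤ n → IsSimple G → IsConnected G →
  ∀ {β} (M₀ : List (Edge G)) → IsMatching G M₀ → size G ∸ length M₀ + 1 ≤ suc β →
  ¬ EdgeLocatingColorable G β → AttainsBound G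
attains-bound G n≥5 simple conn M₀ matching₀ bound≤ ¬β k (M , matching , refl , maximum) =
  matching⇒edgeLocatingColorable G n≥5 simple conn M matching ,
  λ j j<bound colourable → ¬β (EdgeLocatingColorable-mono (ℕ.≤-pred (ℕ.<-≤-trans j<bound
    (ℕ.≤-trans (ℕ.+-monoˡ-≤ 1 (ℕ.∸-monoʳ-≤ (size G) (maximum M₀ matching₀))) bound≤))) colourable)

∸+1≤suc : ∀ {s b} l → s ≤ l + b → s ∸ l + 1 ≤ suc b
∸+1≤suc {s} {b} l s≤l+b = begin
  s ∸ l + 1        ≤⟨ ℕ.+-monoˡ-≤ 1 (ℕ.∸-monoˡ-≤ l s≤l+b) ⟩
  l + b ∸ l + 1    ≡⟨ cong (_+ 1) (ℕ.m+n∸m≡n l b) ⟩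
  b + 1            ≡⟨ ℕ.+-comm b 1 ⟩
  suc b            ∎
  where open ℕ.≤-Reasoning

degree≤colours : ∀ {n} {G : Adj n} {a d j} (h : Fin d → Edge G) → (∀ i → x (h i) ≡ a) →
  (∀ {i i′} → y (h i) ≡ y (h i′) → i ≡ i′) → EdgeLocatingColorable G j → d ≤ j
degree≤colours {d = d} {j} h at-a y-injective (c , proper , _) with d ≤? j
... | yes d≤j = d≤j
... | no  d≰j with i , i′ , i<i′ , same ← Fin.pigeonhole (ℕ.≰⇒> d≰j) (c ∘ h) =
  ⊥-elim (proper (h i) (h i′) (Fin.<⇒≢ i<i′ ∘ y-injective ∘ proj₂) (inj₁ (trans (at-a i) (sym (at-a i′)))) same)

module Exhaustive {n m : ℕ} (G : Adj n) (L : Fin m → Edge G) (cover : ∀ e → ∃[ t ] e ≡ L t)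
                  (D : Fin n → Fin n → ℕ) (D-isDist : ∀ u v → IsDist G u v (D u v)) where
  open Graph G

  dist-to : Fin n → Fin m → ℕ
  dist-to v t = D v (x (L t)) ⊓ D v (y (L t))

  module _ {j} (col : Fin m → Fin j) where

    Improper : Set
    Improper = ∃[ t ] ∃[ t′ ] col t ≡ col t′ × ¬ SameEdge G (L t) (L t′) × Incident G (L t) (L t′)

    -- Domination both ways says d(u, Cᵢ) = d(v, Cᵢ) without computing either minimum.
    Dominated : Fin n → Fin n → Fin j → Set
    Dominated u v i = ∀ t → col t ≡ i → ∃[ t′ ] col t′ ≡ i × dist-to v t′ ≤ dist-to u t

    Indistinct : Set
    Indistinct = ∃[ u ] ∃[ v ] u ≢ v × (∀ i → Dominated u v i × Dominated v u i)

    Flawed : Set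
    Flawed = Improper ⊎ Indistinct

    flawed? : Dec Flawed
    flawed? = improper? ⊎-dec indistinct?
      where
      improper? : Dec Improper
      improper? = Fin.any? λ t → Fin.any? λ t′ → (col t ≟ col t′) ×-dec
        ¬? ((x (L t) ≟ x (L t′)) ×-dec (y (L t) ≟ y (L t′))) ×-dec incident? (L t) (L t′)

      dominated? : ∀ u v i → Dec (Dominated u v i)
      dominated? u v i = Fin.all? λ t → (col t ≟ i) →-dec
        Fin.any? λ t′ → (col t′ ≟ i) ×-dec (dist-to v t′ ≤? dist-to u t)

      indistinct? : Dec Indistinct
      indistinct? = Fin.any? λ u → Fin.any? λ v → ¬? (u ≟ v) ×-dec
        Fin.all? λ i → dominated? u v i ×-dec dominated? v u i

  DistVE-table : ∀ {j} {c : Edge G → Fin j} {v t d} → DistVE G c v (L t) d → d ≡ dist-to v t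
  DistVE-table (_ , _ , px , py , refl) =
    cong₂ _⊓_ (isDist-unique px (D-isDist _ _)) (isDist-unique py (D-isDist _ _))

  module _ {j} (c : Edge G → Fin j) (col : Fin m → Fin j) (col≡c : ∀ t → col t ≡ c (L t)) where

    dominated⇒≤ : ∀ {u v i du dv} → DistVC G c u i du → DistVC G c v i dv → Dominated col u v i → dv ≤ du
    dominated⇒≤ {u} {v} ((e , ce , dve) , _) (_ , least) dom with t , refl ← cover e
      with t′ , col-t′ , t′≤t ← dom t (trans (col≡c t) ce) =
      ℕ.≤-trans (least (L t′) _ (trans (sym (col≡c t′)) col-t′) (_ , _ , D-isDist v _ , D-isDist v _ , refl))
                (subst (dist-to v t′ ≤_) (sym (DistVE-table {c = c} {u} {t} dve)) t′≤t)

    flawed⇒¬locating : Flawed col → ¬ IsEdgeLocating G c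
    flawed⇒¬locating (inj₁ (t , t′ , same , ¬same-edge , inc)) (proper , _) =
      proper (L t) (L t′) ¬same-edge inc (trans (sym (col≡c t)) (trans same (col≡c t′)))
    flawed⇒¬locating (inj₂ (u , v , u≢v , dom)) (_ , locates)
      with i , du , dv , pu , pv , du≢dv ← locates u v u≢v =
      du≢dv (ℕ.≤-antisym (dominated⇒≤ pv pu (proj₂ (dom i))) (dominated⇒≤ pu pv (proj₁ (dom i))))

  all-flawed⇒¬colourable : ∀ {j} → (∀ (cs : Vec (Fin j) m) → Flawed (lookupᵛ cs)) →
                           ¬ EdgeLocatingColorable G j
  all-flawed⇒¬colourable flawed (c , locating) =
    flawed⇒¬locating c (lookupᵛ cs) (lookup∘tabulate (c ∘ L)) (flawed cs) locating
    where cs = tabulate (c ∘ L)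

module Cycle where
  open Graph C5

  C5-edges : Fin 5 → Edge C5
  C5-edges zero                         = mkEdge zero (suc zero)
  C5-edges (suc zero)                   = mkEdge (suc zero) (suc (suc zero))
  C5-edges (suc (suc zero))             = mkEdge (suc (suc zero)) (suc (suc (suc zero)))
  C5-edges (suc (suc (suc zero)))       = mkEdge (suc (suc (suc zero))) (suc (suc (suc (suc zero))))
  C5-edges (suc (suc (suc (suc zero)))) = mkEdge zero (suc (suc (suc (suc zero))))

  C5-dist : Fin 5 → Fin 5 → ℕ
  C5-dist u v = ∣ toℕ u - toℕ v ∣ ⊓ (5 ∸ ∣ toℕ u - toℕ v ∣)

  C5-dist-isDist : ∀ u v → IsDist C5 u v (C5-dist u v)
  C5-dist-isDist = from-yes (Fin.all? λ u → Fin.all? λ v → isDist? u v (C5-dist u v))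

  C5-not-3-colourable : ¬ EdgeLocatingColorable C5 3
  C5-not-3-colourable = all-flawed⇒¬colourable (from-yes (∀-vec? {3} {5} (flawed? ∘ lookupᵛ)))
    where open Exhaustive C5 C5-edges (enumerates⇒cover (from-yes (enumerates? C5-edges))) C5-dist C5-dist-isDist

  C5-attains : AttainsBound C5
  C5-attains = attains-bound C5 ℕ.≤-refl (from-yes simple?) (λ u v → C5-dist u v , proj₁ (C5-dist-isDist u v))
    M₀ (from-yes (matching? M₀)) ℕ.≤-refl C5-not-3-colourable
    where M₀ = C5-edges zero ∷ C5-edges (suc (suc zero)) ∷ []

module Path where
  open Graph P5

  P5-edges : Fin 4 → Edge P5
  P5-edges zero                   = mkEdge zero (suc zero)
  P5-edges (suc zero)             = mkEdge (suc zero) (suc (suc zero))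
  P5-edges (suc (suc zero))       = mkEdge (suc (suc zero)) (suc (suc (suc zero)))
  P5-edges (suc (suc (suc zero))) = mkEdge (suc (suc (suc zero))) (suc (suc (suc (suc zero))))

  P5-dist : Fin 5 → Fin 5 → ℕ
  P5-dist u v = ∣ toℕ u - toℕ v ∣

  P5-dist-isDist : ∀ u v → IsDist P5 u v (P5-dist u v)
  P5-dist-isDist = from-yes (Fin.all? λ u → Fin.all? λ v → isDist? u v (P5-dist u v))

  P5-not-2-colourable : ¬ EdgeLocatingColorable P5 2
  P5-not-2-colourable = all-flawed⇒¬colourable (from-yes (∀-vec? {2} {4} (flawed? ∘ lookupᵛ)))
    where open Exhaustive P5 P5-edges (enumerates⇒cover (from-yes (enumerates? P5-edges))) P5-dist P5-dist-isDist

  P5-attains : AttainsBound P5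
  P5-attains = attains-bound P5 ℕ.≤-refl (from-yes simple?) (λ u v → P5-dist u v , proj₁ (P5-dist-isDist u v))
    M₀ (from-yes (matching? M₀)) ℕ.≤-refl P5-not-2-colourable
    where M₀ = P5-edges zero ∷ P5-edges (suc (suc zero)) ∷ []

module Star (r : ℕ) where
  S : Adj (5 + r)
  S = star (5 + r)

  open Graph S

  spoke : Fin (4 + r) → Edge S
  spoke i = edge zero (suc i) (s≤s z≤n) refl

  spoke-cover : ∀ e → ∃[ i ] e ≡ spoke i
  spoke-cover (edge zero    (suc i) _  _)  = i , edge-≡ refl refl
  spoke-cover (edge zero    zero    () _)
  spoke-cover (edge (suc a) zero    () _)
  spoke-cover (edge (suc a) (suc b) _  ())

  to-centre : ∀ a → ∃[ ℓ ] Walk S a zero ℓ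
  to-centre zero    = 0 , nil
  to-centre (suc a) = 1 , cons refl nil

  from-centre : ∀ a → ∃[ ℓ ] Walk S zero a ℓ
  from-centre zero    = 0 , nil
  from-centre (suc a) = 1 , cons refl nil

  attains : AttainsBound S
  attains = attains-bound S (s≤s (s≤s (s≤s (s≤s (s≤s z≤n)))))
    ((λ u v → Bool.xor-comm (toℕ u ≡ᵇ 0) (toℕ v ≡ᵇ 0)) , λ v → Bool.xor-same (toℕ v ≡ᵇ 0))
    (connected-via zero to-centre from-centre)
    (spoke zero ∷ []) ([] ∷ []) (∸+1≤suc 1 (size≤ spoke spoke-cover))
    λ colourable → ℕ.<-irrefl refl (degree≤colours spoke (λ _ → refl) Fin.suc-injective colourable)

star-attains : ∀ n → 5 ≤ n → AttainsBound (star n)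
star-attains _ (s≤s (s≤s (s≤s (s≤s (s≤s (z≤n {r})))))) = Star.attains r

-- doubleStar p unfolds to doubleStarOn (p + 3); stating the construction for an arbitrary
-- vertex count lets the proof pattern match on that count.
doubleStarArcs : ∀ m → Adj m
doubleStarArcs m i j =
  ((toℕ i ≡ᵇ 0) ∧ (toℕ j ≡ᵇ 1)) ∨ ((toℕ i ≡ᵇ 1) ∧ (toℕ j ≡ᵇ 2)) ∨
  ((toℕ i ≡ᵇ 0) ∧ (2 <ᵇ toℕ j))

doubleStarOn : ∀ m → Adj m
doubleStarOn m = symClose (doubleStarArcs m)

module DoubleStar (r : ℕ) where
  S : Adj (5 + r)
  S = doubleStarOn (5 + r)

  open Graph S

  S-edges : Fin (4 + r) → Edge S
  S-edges zero          = edge zero (suc zero) (s≤s z≤n) refl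
  S-edges (suc zero)    = edge (suc zero) (suc (suc zero)) (s≤s (s≤s z≤n)) refl
  S-edges (suc (suc i)) = edge zero (suc (suc (suc i))) (s≤s z≤n) refl

  S-edges-cover : ∀ e → ∃[ t ] e ≡ S-edges t
  S-edges-cover (edge zero             (suc zero)             _ _) = zero , edge-≡ refl refl
  S-edges-cover (edge (suc zero)       (suc (suc zero))       _ _) = suc zero , edge-≡ refl refl
  S-edges-cover (edge zero             (suc (suc (suc i)))    _ _) = suc (suc i) , edge-≡ refl refl
  S-edges-cover (edge zero             zero                   () _)
  S-edges-cover (edge zero             (suc (suc zero))       _ ())
  S-edges-cover (edge (suc zero)       zero                   () _)
  S-edges-cover (edge (suc zero)       (suc zero)             (s≤s ()) _)
  S-edges-cover (edge (suc zero)       (suc (suc (suc j)))    _ ())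
  S-edges-cover (edge (suc (suc a))    zero                   () _)
  S-edges-cover (edge (suc (suc a))    (suc zero)             (s≤s ()) _)
  S-edges-cover (edge (suc (suc a))    (suc (suc zero))       (s≤s (s≤s ())) _)
  S-edges-cover (edge (suc (suc a))    (suc (suc (suc b)))    _ ())

  loopless : ∀ v → S v v ≡ false
  loopless zero                = refl
  loopless (suc zero)          = refl
  loopless (suc (suc zero))    = refl
  loopless (suc (suc (suc i))) = refl

  to-centre : ∀ a → ∃[ ℓ ] Walk S a zero ℓ
  to-centre zero                = 0 , nil
  to-centre (suc zero)          = 1 , cons refl nil
  to-centre (suc (suc zero))    = 2 , cons {w = suc zero} refl (cons refl nil)
  to-centre (suc (suc (suc i))) = 1 , cons refl nil

  from-centre : ∀ a → ∃[ ℓ ] Walk S zero a ℓ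
  from-centre zero                = 0 , nil
  from-centre (suc zero)          = 1 , cons refl nil
  from-centre (suc (suc zero))    = 2 , cons {w = suc zero} refl (cons refl nil)
  from-centre (suc (suc (suc i))) = 1 , cons refl nil

  centre-edges : Fin (3 + r) → Edge S
  centre-edges zero    = S-edges zero
  centre-edges (suc i) = S-edges (suc (suc i))

  centre-edges-x : ∀ i → x (centre-edges i) ≡ zero
  centre-edges-x zero    = refl
  centre-edges-x (suc i) = refl

  centre-edges-y-injective : ∀ {i i′} → y (centre-edges i) ≡ y (centre-edges i′) → i ≡ i′
  centre-edges-y-injective {zero}  {zero}   _  = refl
  centre-edges-y-injective {suc i} {suc i′} eq =
    cong suc (Fin.suc-injective (Fin.suc-injective (Fin.suc-injective eq)))

  attains : AttainsBound S
  attains = attains-bound S (s≤s (s≤s (s≤s (s≤s (s≤s z≤n)))))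
    ((λ u v → Bool.∨-comm (doubleStarArcs _ u v) _) , loopless) (connected-via zero to-centre from-centre)
    M₀ (from-yes (matching? M₀)) (∸+1≤suc 2 (size≤ S-edges S-edges-cover))
    λ colourable → ℕ.<-irrefl refl
      (degree≤colours centre-edges centre-edges-x centre-edges-y-injective colourable)
    where M₀ = S-edges (suc (suc zero)) ∷ S-edges (suc zero) ∷ []

doubleStarOn-attains : ∀ m → 5 ≤ m → AttainsBound (doubleStarOn m)
doubleStarOn-attains _ (s≤s (s≤s (s≤s (s≤s (s≤s (z≤n {r})))))) = DoubleStar.attains r

doubleStar-attains : ∀ p → 2 ≤ p → AttainsBound (doubleStar p)
doubleStar-attains p 2≤p = doubleStarOn-attains (p + 3) (ℕ.+-monoˡ-≤ 3 2≤p)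

theorem14 : (∀ n (G : Adj n) → 5 ≤ n → IsSimple G → IsConnected G →
    ∀ k → HasMaximumMatchingOfSize G k →
    ∃[ χ ] χ ≤ size G ∸ k + 1 × EdgeLocatingColorable G χ)
    × AttainsBound C5
    × AttainsBound P5
    × (∀ n → 5 ≤ n → AttainsBound (star n))
    × (∀ p → 2 ≤ p → AttainsBound (doubleStar p))
theorem14 = upper-bound , Cycle.C5-attains , Path.P5-attains , star-attains , doubleStar-attains
  where
  upper-bound : ∀ n (G : Adj n) → 5 ≤ n → IsSimple G → IsConnected G →
    ∀ k → HasMaximumMatchingOfSize G k → ∃[ χ ] χ ≤ size G ∸ k + 1 × EdgeLocatingColorable G χ
  upper-bound _ G n≥5 simple conn _ (M , matching , refl , _) =
    _ , ℕ.≤-refl , matching⇒edgeLocatingColorable G n≥5 simple conn M matching
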